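{- $\textsc{Empty-Child-w-Height}$ is in $\mathsf{PLS}^{dt}$, and therefore in $\mathsf{SOPL}^{dt}$.
   Context: Query model with $\le_{dt}$ reductions (decision-tree reductions whose log input length plus depth is $\mathrm{polylog}(N)$). $\textsc{Empty-Child-w-Height}$: the input is $V=[N]$ and functions $F,L,R:V\to V$, $H:V\to[N]$. A solution is (s1) $u\in V$ with $F(L(u))\neq u$ or $F(R(u))\neq u$ or $L(u)=R(u)\neq u$; (s2) the vertex $1$ if $L(1)=1$ or $R(1)=1$ or $F(1)\ne1$; or (s4) a vertex $u\in V\setminus\{1\}$ with $u\neq F(u)$ and $H(u)\neq H(F(u))+1$, or the vertex $1$ if $H(1)\neq 1$. $\mathsf{PLS}^{dt}$: query problems $\le_{dt}$-reducible to $\textsc{Sink-Of-DAG}$ (given $s:[N]\to[N]$, $h:[N]\to[N]$, find $1$ if $s(1)=1$, or $v$ with $s(v)\neq v$ and ($s(s(v))=s(v)$ or $h(s(v))\le h(v)$)). $\mathsf{SOPL}^{dt}$: query problems $\le_{dt}$-reducible to $\textsc{Sink-Of-Metered-Line}$: given $S,P:[N]\to[N]$ and $W:[N]\to[N]\cup\{0\}$, a solution is $1$ if $P(1)\neq1$ or $S(1)=1$ or $W(1)\neq1$; or $x$ with $P(S(x))\neq x$; or $x\neq 1$ with $W(x)=1$; or $x$ with ($W(x)>0$ and $W(S(x))-W(x)\neq1$) or ($W(x)>1$ and $W(x)-W(P(x))\neq1$). -}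

module Defs where

open import Level using (0ℓ)
open import Data.Nat using (ℕ; zero; suc; _+_; _*_; _^_; _≤_; _<_)
open import Data.Nat.Logarithm using (⌈log₂_⌉)
open import Data.Fin using (Fin; toℕ) renaming (zero to fzero)
open import Data.Product using (Σ; ∃; ∃-syntax; _×_; _,_)
open import Data.Sum using (_⊎_)
open import Relation.Binary.PropositionalEquality using (_≡_; _≢_)

data DT (Q : Set) (A : Q → Set) (B : Set) : Set where
  leaf : B → DT Q A B
  node : (q : Q) → (A q → DT Q A B) → DT Q A B

eval : ∀ {Q A B} → DT Q A B → ((q : Q) → A q) → B
eval (leaf b)   x = b
eval (node q k) x = eval (k (x q)) x

data DepthLE {Q : Set} {A : Q → Set} {B : Set} : DT Q A B → ℕ → Set where
  leaf≤ : ∀ {b d} → DepthLE (leaf b) d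
  node≤ : ∀ {q k d} → (∀ a → DepthLE (k a) d) → DepthLE (node q k) (suc d)

-- Query (search) problems, indexed by n; the instance size is N = suc n
-- (vertex set [N] is encoded as Fin (suc n), the vertex 1 being fzero,
-- and a value v ∈ [N] used as a number is toℕ v + 1).

record QueryProblem : Set₁ where
  field
    Query  : ℕ → Set
    Ans    : (n : ℕ) → Query n → Set
    Sol    : ℕ → Set
    IsSol  : (n : ℕ) → ((q : Query n) → Ans n q) → Sol n → Set

open QueryProblem public

record _≤dt_ (P R : QueryProblem) : Set where
  field
    size    : ℕ → ℕ
    inp     : (n : ℕ) → (q : Query R (size n)) →
              DT (Query P n) (Ans P n) (Ans R (size n) q)
    out     : (n : ℕ) → Sol R (size n) → DT (Query P n) (Ans P n) (Sol P n)
    correct : (n : ℕ) (x : (q : Query P n) → Ans P n q) (o : Sol R (size n)) →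
              IsSol R (size n) (λ q → eval (inp n q) x) o →
              IsSol P n x (eval (out n o) x)
    depth   : ℕ → ℕ
    inp-depth : (n : ℕ) (q : Query R (size n)) → DepthLE (inp n q) (depth n)
    out-depth : (n : ℕ) (o : Sol R (size n)) → DepthLE (out n o) (depth n)
    polylog : ∃[ c ] ∃[ k ] ((n : ℕ) →
              ⌈log₂ (suc (size n)) ⌉ + depth n ≤ c * (suc ⌈log₂ (suc n) ⌉) ^ k)

data ECQuery (n : ℕ) : Set where
  qF qL qR qH : Fin (suc n) → ECQuery n

module _ {n : ℕ} (x : ECQuery n → Fin (suc n)) where
  ecF ecL ecR ecH : Fin (suc n) → Fin (suc n)
  ecF u = x (qF u)
  ecL u = x (qL u)
  ecR u = x (qR u)
  ecH u = x (qH u)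

  ECSol : Fin (suc n) → Set
  ECSol u =
    (ecF (ecL u) ≢ u ⊎ ecF (ecR u) ≢ u ⊎ (ecL u ≡ ecR u × ecL u ≢ u))
    ⊎ (u ≡ fzero × (ecL fzero ≡ fzero ⊎ ecR fzero ≡ fzero ⊎ ecF fzero ≢ fzero))
    ⊎ (u ≢ fzero × u ≢ ecF u × toℕ (ecH u) ≢ toℕ (ecH (ecF u)) + 1)
    ⊎ (u ≡ fzero × toℕ (ecH fzero) ≢ 0)

EmptyChildWHeight : QueryProblem
EmptyChildWHeight = record
  { Query = ECQuery
  ; Ans   = λ n _ → Fin (suc n)
  ; Sol   = λ n → Fin (suc n)
  ; IsSol = λ n x u → ECSol x u
  }

data SDQuery (n : ℕ) : Set where
  qs qh : Fin (suc n) → SDQuery n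

SDSol : {n : ℕ} → (SDQuery n → Fin (suc n)) → Fin (suc n) → Set
SDSol x v =
  (v ≡ fzero × s fzero ≡ fzero)
  ⊎ (s v ≢ v × (s (s v) ≡ s v ⊎ toℕ (h (s v)) ≤ toℕ (h v)))
  where
  s = λ u → x (qs u)
  h = λ u → x (qh u)

SinkOfDAG : QueryProblem
SinkOfDAG = record
  { Query = SDQuery
  ; Ans   = λ n _ → Fin (suc n)
  ; Sol   = λ n → Fin (suc n)
  ; IsSol = λ n x v → SDSol x v
  }

-- Sink-Of-Metered-Line  (W values in [N] ∪ {0} = Fin (suc N), value = toℕ)

data MLQuery (n : ℕ) : Set where
  qS qP qW : Fin (suc n) → MLQuery n

MLAns : (n : ℕ) → MLQuery n → Set
MLAns n (qS _) = Fin (suc n)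
MLAns n (qP _) = Fin (suc n)
MLAns n (qW _) = Fin (suc (suc n))

MLSol : {n : ℕ} → ((q : MLQuery n) → MLAns n q) → Fin (suc n) → Set
MLSol x v =
  (v ≡ fzero × (P fzero ≢ fzero ⊎ S fzero ≡ fzero ⊎ W fzero ≢ 1))
  ⊎ P (S v) ≢ v
  ⊎ (v ≢ fzero × W v ≡ 1)
  ⊎ (0 < W v × W (S v) ≢ W v + 1)
  ⊎ (1 < W v × W v ≢ W (P v) + 1)
  where
  S = λ u → x (qS u)
  P = λ u → x (qP u)
  W = λ u → toℕ (x (qW u))

SinkOfMeteredLine : QueryProblem
SinkOfMeteredLine = record
  { Query = MLQuery
  ; Ans   = MLAns
  ; Sol   = λ n → Fin (suc n)
  ; IsSol = λ n x v → MLSol x v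
  }

InPLSdt : QueryProblem → Set
InPLSdt P = P ≤dt SinkOfDAG

InSOPLdt : QueryProblem → Set
InSOPLdt P = P ≤dt SinkOfMeteredLine

-- Both reductions answer a solution v of the target instance with the first genuine solution
-- among root, u, L u, R u (u determined by v), each candidate being checked by querying the eleven
-- values that certify it. For Sink-of-DAG the successor is the left child and the potential is the
-- height: at a sink v either F (L v) ≠ v, or L v is the root with a parent, or L v has no left child,
-- or L v does not sit one level above v.
--
-- For Sink-of-Metered-Line the line starts at a fresh vertex of weight 1, enters the root and then
-- follows first children (L u, or R u when L u = u); vertex u gets weight H u + 2 and its parent as
-- predecessor. Isolated vertices (u ≠ root, L u = R u = u) get weight 0. A vertex that is not the
-- first child of its parent (an orphan) still needs a predecessor of weight one less: it gets a
-- ladder of H u rungs of weights 2, …, H u + 1 whose predecessor chain ends at the start vertex.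
-- Ladders carry no defects of the metered line, and every defect at a tree vertex u exposes a
-- violated local condition at root, u, L u or R u.

module Submission where

open import Data.Bool using (true; false; if_then_else_)
open import Data.Fin using (Fin; toℕ; combine; remQuot; inject₁; inject≤) renaming (zero to fzero; suc to fsuc)
open import Data.Fin.Properties using (_≟_; toℕ-injective; toℕ<n; toℕ-inject₁; toℕ-inject≤; remQuot-combine; combine-remQuot)
open import Data.List using (List; []; _∷_; length)
open import Data.List.Relation.Unary.Any using (Any; here; there; tail)
open import Data.Nat using (ℕ; zero; suc; _+_; _*_; _^_; _≤_; _<_; z≤n; s≤s; ⌊_/2⌋; ⌈_/2⌉)
import Data.Nat as ℕ
import Data.Nat.Properties as ℕₚ
open import Data.Nat.Induction using (<-wellFounded)
open import Data.Nat.Logarithm using (⌈log₂_⌉; ⌈log₂⌉-mono-≤; ⌈log₂2^n⌉≡n)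
open import Data.Nat.Logarithm.Core using (⌈log2⌉)
open import Data.Nat.Tactic.RingSolver using (solve-∀)
open import Data.Product using (_×_; _,_; proj₁; proj₂; uncurry)
open import Data.Sum using (_⊎_; inj₁; inj₂)
import Data.Sum as Sum
open import Function using (_∘_)
open import Induction.WellFounded using (Acc; acc)
open import Relation.Binary.PropositionalEquality
open import Relation.Nullary using (¬_; Dec; yes; no; does; contradiction)
open import Relation.Nullary.Decidable using (_×-dec_; _⊎-dec_; ¬?)
open import Defs

module _ {Q : Set} {A : Q → Set} where

  ask : (q : Q) → DT Q A (A q)
  ask q = node q leaf

  _>>=_ : ∀ {B C} → DT Q A B → (B → DT Q A C) → DT Q A C
  leaf b   >>= k = k b
  node q t >>= k = node q λ a → t a >>= k

  DepthLE-weaken : ∀ {B} {t : DT Q A B} {d e} → d ≤ e → DepthLE t d → DepthLE t e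
  DepthLE-weaken _       leaf≤     = leaf≤
  DepthLE-weaken (s≤s p) (node≤ h) = node≤ λ a → DepthLE-weaken p (h a)

  DepthLE->>= : ∀ {B C} {t : DT Q A B} {k : B → DT Q A C} {d e} →
                DepthLE t d → (∀ b → DepthLE (k b) e) → DepthLE (t >>= k) (d + e)
  DepthLE->>= {d = d} leaf≤ hk = DepthLE-weaken (ℕₚ.m≤n+m _ d) (hk _)
  DepthLE->>= (node≤ ht) hk = node≤ λ a → DepthLE->>= (ht a) hk

n≤2^⌈log₂n⌉ : ∀ n → n ≤ 2 ^ ⌈log₂ n ⌉
n≤2^⌈log₂n⌉ n = go n (<-wellFounded n)
  where
  2+n≤2*[1+⌈n/2⌉] : ∀ n → 2 + n ≤ 2 * suc ⌈ n /2⌉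
  2+n≤2*[1+⌈n/2⌉] n = begin
    2 + n                              ≡⟨ cong (2 +_) (ℕₚ.⌊n/2⌋+⌈n/2⌉≡n n) ⟨
    2 + (⌊ n /2⌋ + ⌈ n /2⌉)            ≤⟨ ℕₚ.+-monoʳ-≤ 2 (ℕₚ.+-monoˡ-≤ _ (ℕₚ.⌊n/2⌋≤⌈n/2⌉ n)) ⟩
    2 + (⌈ n /2⌉ + ⌈ n /2⌉)            ≡⟨ double ⌈ n /2⌉ ⟩
    2 * suc ⌈ n /2⌉                    ∎
    where
    open ℕₚ.≤-Reasoning
    double : ∀ c → 2 + (c + c) ≡ 2 * suc c
    double = solve-∀

  go : ∀ n (rec : Acc _<_ n) → n ≤ 2 ^ ⌈log2⌉ n rec
  go 0 _ = z≤n
  go 1 _ = s≤s z≤n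
  go (suc (suc n)) (acc rs) =
    ℕₚ.≤-trans (2+n≤2*[1+⌈n/2⌉] n) (ℕₚ.*-monoʳ-≤ 2 (go (suc ⌈ n /2⌉) (rs (ℕₚ.⌈n/2⌉<n n))))

⌈log₂⌉≤ : ∀ {m} k → m ≤ 2 ^ k → ⌈log₂ m ⌉ ≤ k
⌈log₂⌉≤ k m≤2^k = ℕₚ.≤-trans (⌈log₂⌉-mono-≤ m≤2^k) (ℕₚ.≤-reflexive (⌈log₂2^n⌉≡n k))

⌈log₂[1+m*[1+m]]⌉≤ : ∀ m → ⌈log₂ (suc (m * suc m)) ⌉ ≤ suc ⌈log₂ m ⌉ + suc ⌈log₂ m ⌉
⌈log₂[1+m*[1+m]]⌉≤ m = ⌈log₂⌉≤ (suc l + suc l) (begin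
  suc (m * suc m)  ≤⟨ s≤s (ℕₚ.m≤n+m (m * suc m) m) ⟩
  suc m * suc m    ≤⟨ ℕₚ.*-mono-≤ 1+m≤2^[1+l] 1+m≤2^[1+l] ⟩
  2 ^ suc l * 2 ^ suc l ≡⟨ ℕₚ.^-distribˡ-+-* 2 (suc l) (suc l) ⟨
  2 ^ (suc l + suc l) ∎)
  where
  open ℕₚ.≤-Reasoning
  l : ℕ
  l = ⌈log₂ m ⌉
  1+m≤2^[1+l] : suc m ≤ 2 ^ suc l
  1+m≤2^[1+l] = ℕₚ.+-mono-≤ (ℕₚ.m^n>0 2 l)
    (ℕₚ.≤-trans (n≤2^⌈log₂n⌉ m) (ℕₚ.≤-reflexive (sym (ℕₚ.+-identityʳ (2 ^ l)))))

≤-linear⇒≤-polylog : ∀ {a} b c l → a ≤ b + c * l → a ≤ (b + c) * suc l ^ 1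
≤-linear⇒≤-polylog {a} b c l a≤ = begin
  a                                ≤⟨ a≤ ⟩
  b + c * l                        ≤⟨ ℕₚ.m≤m+n (b + c * l) (c + b * l) ⟩
  (b + c * l) + (c + b * l)        ≡⟨ expand b c l ⟩
  (b + c) * (1 + l)                ≡⟨ cong ((b + c) *_) (ℕₚ.^-identityʳ (suc l)) ⟨
  (b + c) * suc l ^ 1              ∎
  where
  open ℕₚ.≤-Reasoning
  expand : ∀ b c l → (b + c * l) + (c + b * l) ≡ (b + c) * (1 + l)
  expand = solve-∀

root : ∀ {n} → Fin (suc n)
root = fzero

module _ {n : ℕ} where

  private
    Vertex : Set
    Vertex = Fin (suc n)
    Tr : Set → Set
    Tr = DT (ECQuery n) (λ _ → Vertex)

  record Certificate : Set where
    field l r fl fr f h hf l₀ r₀ f₀ h₀ : Vertex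

  certificate : (ECQuery n → Vertex) → Vertex → Certificate
  certificate x u = record
    { l = ecL x u ; r = ecR x u ; fl = ecF x (ecL x u) ; fr = ecF x (ecR x u)
    ; f = ecF x u ; h = ecH x u ; hf = ecH x (ecF x u)
    ; l₀ = ecL x root ; r₀ = ecR x root ; f₀ = ecF x root ; h₀ = ecH x root }

  certificateTree : Vertex → Tr Certificate
  certificateTree u = do
    l ← ask (qL u)
    r ← ask (qR u)
    fl ← ask (qF l)
    fr ← ask (qF r)
    f ← ask (qF u)
    h ← ask (qH u)
    hf ← ask (qH f)
    l₀ ← ask (qL root)
    r₀ ← ask (qR root)
    f₀ ← ask (qF root)
    h₀ ← ask (qH root)
    leaf (record { l = l ; r = r ; fl = fl ; fr = fr ; f = f ; h = h ; hf = hf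
                 ; l₀ = l₀ ; r₀ = r₀ ; f₀ = f₀ ; h₀ = h₀ })

  certificateTree-depth : ∀ u → DepthLE (certificateTree u) 11
  certificateTree-depth u =
    node≤ λ _ → node≤ λ _ → node≤ λ _ → node≤ λ _ → node≤ λ _ → node≤ λ _ →
    node≤ λ _ → node≤ λ _ → node≤ λ _ → node≤ λ _ → node≤ λ _ → leaf≤

  -- Mirrors ECSol clause by clause, so that ECSol x u is Certifies u (certificate x u) by computation.
  Certifies : Vertex → Certificate → Set
  Certifies u c =
    (fl ≢ u ⊎ fr ≢ u ⊎ (l ≡ r × l ≢ u))
    ⊎ (u ≡ root × (l₀ ≡ root ⊎ r₀ ≡ root ⊎ f₀ ≢ root))
    ⊎ (u ≢ root × u ≢ f × toℕ h ≢ toℕ hf + 1)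
    ⊎ (u ≡ root × toℕ h₀ ≢ 0)
    where open Certificate c

  certifies? : ∀ u c → Dec (Certifies u c)
  certifies? u c =
    (¬? (fl ≟ u) ⊎-dec ¬? (fr ≟ u) ⊎-dec (l ≟ r ×-dec ¬? (l ≟ u)))
    ⊎-dec (u ≟ root ×-dec (l₀ ≟ root ⊎-dec r₀ ≟ root ⊎-dec ¬? (f₀ ≟ root)))
    ⊎-dec (¬? (u ≟ root) ×-dec ¬? (u ≟ f) ×-dec ¬? (toℕ h ℕ.≟ toℕ hf + 1))
    ⊎-dec (u ≟ root ×-dec ¬? (toℕ h₀ ℕ.≟ 0))
    where open Certificate c

  firstSolution : List Vertex → Tr Vertex
  firstSolution []       = leaf root
  firstSolution (u ∷ us) = certificateTree u >>= λ c →
    if does (certifies? u c) then leaf u else firstSolution us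

  firstSolution-correct : ∀ x us → Any (ECSol x) us → ECSol x (eval (firstSolution us) x)
  firstSolution-correct x (u ∷ us) sol = branch (certifies? u (certificate x u))
    where
    branch : (d : Dec (ECSol x u)) →
             ECSol x (eval (if does d then leaf u else firstSolution us) x)
    branch (yes u-sol) = u-sol
    branch (no ¬u-sol) = firstSolution-correct x us (tail ¬u-sol sol)

  firstSolution-depth : ∀ us → DepthLE (firstSolution us) (length us * 11)
  firstSolution-depth []       = leaf≤
  firstSolution-depth (u ∷ us) =
    DepthLE->>= (certificateTree-depth u) λ c → branch (does (certifies? u c))
    where
    branch : ∀ b → DepthLE (if b then leaf u else firstSolution us) (length us * 11)
    branch true  = leaf≤
    branch false = firstSolution-depth us

  searchNear : Vertex → Tr Vertex
  searchNear u = do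
    l ← ask (qL u)
    r ← ask (qR u)
    firstSolution (root ∷ u ∷ l ∷ r ∷ [])

  searchNear-depth : ∀ u → DepthLE (searchNear u) 46
  searchNear-depth u = node≤ λ _ → node≤ λ _ → firstSolution-depth (root ∷ u ∷ _ ∷ _ ∷ [])

module _ {n : ℕ} (x : ECQuery n → Fin (suc n)) where

  private
    Vertex : Set
    Vertex = Fin (suc n)
    L R F H : Vertex → Vertex
    L = ecL x
    R = ecR x
    F = ecF x
    H = ecH x

  Near : Vertex → Set
  Near u = Any (ECSol x) (root ∷ u ∷ L u ∷ R u ∷ [])

  searchNear-correct : ∀ u → Near u → ECSol x (eval (searchNear u) x)
  searchNear-correct u = firstSolution-correct x (root ∷ u ∷ L u ∷ R u ∷ [])

  near-root : ∀ {u} → ECSol x root → Near u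
  near-root = here

  near-self : ∀ {u} → ECSol x u → Near u
  near-self = there ∘ here

  near-left : ∀ {u} → ECSol x (L u) → Near u
  near-left = there ∘ there ∘ here

  near-right : ∀ {u} → ECSol x (R u) → Near u
  near-right = there ∘ there ∘ there ∘ here

  s1-left : ∀ {u} → F (L u) ≢ u → ECSol x u
  s1-left = inj₁ ∘ inj₁

  s1-right : ∀ {u} → F (R u) ≢ u → ECSol x u
  s1-right = inj₁ ∘ inj₂ ∘ inj₁

  s2-childless : L root ≡ root → ECSol x root
  s2-childless L0≡0 = inj₂ (inj₁ (refl , inj₁ L0≡0))

  s2-parented : ∀ {c u} → c ≡ root → F c ≡ u → c ≢ u → ECSol x root
  s2-parented refl Fc≡u c≢u = inj₂ (inj₁ (refl , inj₂ (inj₂ λ F0≡0 → c≢u (trans (sym F0≡0) Fc≡u))))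

  s4 : ∀ {u} → u ≢ root → u ≢ F u → toℕ (H u) ≢ toℕ (H (F u)) + 1 → ECSol x u
  s4 u≢0 u≢Fu bad = inj₂ (inj₂ (inj₁ (u≢0 , u≢Fu , bad)))

  s4-root : toℕ (H root) ≢ 0 → ECSol x root
  s4-root H0≢0 = inj₂ (inj₂ (inj₂ (refl , H0≢0)))

  child-sol : ∀ {u w} → F w ≡ u → w ≢ u → w ≢ root →
              L w ≡ w ⊎ toℕ (H w) ≢ toℕ (H u) + 1 → ECSol x w
  child-sol Fw≡u w≢u w≢0 (inj₁ Lw≡w) =
    s1-left λ FLw≡w → w≢u (trans (sym FLw≡w) (trans (cong F Lw≡w) Fw≡u))
  child-sol {u} {w} Fw≡u w≢u w≢0 (inj₂ bad) =
    s4 w≢0 (λ w≡Fw → w≢u (trans w≡Fw Fw≡u)) (subst (λ p → toℕ (H w) ≢ toℕ (H p) + 1) (sym Fw≡u) bad)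

-- Reduction to Sink-of-DAG

module ToSinkOfDAG where

  input : (n : ℕ) (q : SDQuery n) → DT (ECQuery n) (λ _ → Fin (suc n)) (Fin (suc n))
  input n (qs u) = ask (qL u)
  input n (qh u) = ask (qH u)

  sink⇒near : ∀ {n} (x : ECQuery n → Fin (suc n)) v →
              SDSol (λ q → eval (input n q) x) v → Near x v
  sink⇒near x v (inj₁ (refl , L0≡0)) = near-root x (s2-childless x L0≡0)
  sink⇒near x v (inj₂ (Lv≢v , step)) with ecF x (ecL x v) ≟ v | ecL x v ≟ root
  ... | no FLv≢v | _         = near-self x (s1-left x FLv≢v)
  ... | yes FLv≡v | yes Lv≡0 = near-root x (s2-parented x Lv≡0 FLv≡v Lv≢v)
  ... | yes FLv≡v | no Lv≢0  = near-left x (child-sol x FLv≡v Lv≢v Lv≢0 (Sum.map₂ not-ascending step))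
    where
    not-ascending : toℕ (ecH x (ecL x v)) ≤ toℕ (ecH x v) → toℕ (ecH x (ecL x v)) ≢ toℕ (ecH x v) + 1
    not-ascending ≤h e = ℕₚ.<⇒≱ (subst (toℕ (ecH x v) <_) (sym e) (ℕₚ.≤-reflexive (ℕₚ.+-comm 1 _))) ≤h

EmptyChildWHeight≤SinkOfDAG : EmptyChildWHeight ≤dt SinkOfDAG
EmptyChildWHeight≤SinkOfDAG = record
  { size      = λ n → n
  ; inp       = ToSinkOfDAG.input
  ; out       = λ n v → searchNear v
  ; correct   = λ n x v sol → searchNear-correct x v (ToSinkOfDAG.sink⇒near x v sol)
  ; depth     = λ _ → 46
  ; inp-depth = λ { n (qs u) → node≤ λ _ → leaf≤ ; n (qh u) → node≤ λ _ → leaf≤ }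
  ; out-depth = λ n v → searchNear-depth v
  ; polylog   = 47 , 1 , λ n →
      ≤-linear⇒≤-polylog 46 1 ⌈log₂ (suc n) ⌉ (ℕₚ.≤-reflexive (rearrange ⌈log₂ (suc n) ⌉))
  }
  where
  rearrange : ∀ l → l + 46 ≡ 46 + 1 * l
  rearrange = solve-∀

-- Reduction to Sink-of-Metered-Line

inc : ∀ {k} → Fin (suc k) → Fin (suc k)
inc {zero}  i        = i
inc {suc k} fzero    = fsuc fzero
inc {suc k} (fsuc i) = fsuc (inc i)

toℕ-inc : ∀ {k} (i : Fin (suc k)) → toℕ i < k → toℕ (inc i) ≡ suc (toℕ i)
toℕ-inc {suc k} fzero    _       = refl
toℕ-inc {suc k} (fsuc i) (s≤s p) = cong suc (toℕ-inc i p)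

module ToSinkOfMeteredLine (n : ℕ) where

  N M : ℕ
  N = suc n
  M = N * suc N

  Vertex : Set
  Vertex = Fin N

  Tr : Set → Set
  Tr = DT (ECQuery n) (λ _ → Vertex)

  record Nbhd : Set where
    field left right parent parentLeft parentRight height : Vertex
  open Nbhd

  firstChild : (u l r : Vertex) → Vertex
  firstChild u l r = if does (l ≟ u) then r else l

  IsDead IsAdopted IsOrphan : Vertex → Nbhd → Set
  IsDead    u v = u ≢ root × left v ≡ u × right v ≡ u
  IsAdopted u v = parent v ≢ u × firstChild (parent v) (parentLeft v) (parentRight v) ≡ u
  IsOrphan  u v = u ≢ root × ¬ IsDead u v × ¬ IsAdopted u v

  IsRung : Vertex → Vertex → Nbhd → Set
  IsRung p j v = IsOrphan p v × toℕ j < toℕ (height v)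

  -- Opaque, so that with-abstraction over these decisions finds them in goals.
  opaque
    isDead? : ∀ u v → Dec (IsDead u v)
    isDead? u v = ¬? (u ≟ root) ×-dec left v ≟ u ×-dec right v ≟ u

    isAdopted? : ∀ u v → Dec (IsAdopted u v)
    isAdopted? u v = ¬? (parent v ≟ u) ×-dec firstChild (parent v) (parentLeft v) (parentRight v) ≟ u

    isRung? : ∀ p j v → Dec (IsRung p j v)
    isRung? p j v =
      (¬? (p ≟ root) ×-dec ¬? (isDead? p v) ×-dec ¬? (isAdopted? p v)) ×-dec toℕ j ℕ.<? toℕ (height v)

  data LineVertex : Set where
    start  : LineVertex
    vertex : Vertex → LineVertex
    rung   : Vertex → Vertex → LineVertex

  owner : LineVertex → Vertex
  owner start      = root
  owner (vertex u) = u
  owner (rung p j) = p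

  -- The line vertex of weight toℕ k + 1 on p's ladder; the bottom one is start.
  ladder : Vertex → Vertex → LineVertex
  ladder p fzero    = start
  ladder p (fsuc k) = rung p (inject₁ k)

  succAt : LineVertex → Nbhd → LineVertex
  succAt start      v = vertex root
  succAt (vertex u) v = vertex (firstChild u (left v) (right v))
  succAt (rung p j) v =
    if does (isRung? p j v)
    then (if does (suc (toℕ j) ℕ.≟ toℕ (height v)) then vertex p else rung p (inc j))
    else rung p j

  predAt : LineVertex → Nbhd → LineVertex
  predAt start      v = start
  predAt (vertex u) v =
    if does (u ≟ root) then start
    else if does (isAdopted? u v) then vertex (parent v)
    else if does (isDead? u v) then vertex u
    else ladder u (height v)
  predAt (rung p j) v = if does (isRung? p j v) then ladder p j else rung p j

  weightAt : LineVertex → Nbhd → Fin (suc (suc N))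
  weightAt start      v = fsuc fzero
  weightAt (vertex u) v = if does (isDead? u v) then fzero else fsuc (fsuc (height v))
  weightAt (rung p j) v = if does (isRung? p j v) then fsuc (fsuc j) else fzero

  encode : LineVertex → Fin (suc M)
  encode start      = fzero
  encode (vertex u) = fsuc (combine u fzero)
  encode (rung p j) = fsuc (combine p (fsuc j))

  decodePair : Vertex × Fin (suc N) → LineVertex
  decodePair (p , fzero)  = vertex p
  decodePair (p , fsuc j) = rung p j

  decode : Fin (suc M) → LineVertex
  decode fzero    = start
  decode (fsuc k) = decodePair (remQuot (suc N) k)

  decode-encode : ∀ s → decode (encode s) ≡ s
  decode-encode start      = refl
  decode-encode (vertex u) = cong decodePair (remQuot-combine u fzero)
  decode-encode (rung p j) = cong decodePair (remQuot-combine p (fsuc j))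

  encode-decode : ∀ o → encode (decode o) ≡ o
  encode-decode fzero    = refl
  encode-decode (fsuc k) = trans (encode-decodePair (remQuot (suc N) k)) (cong fsuc (combine-remQuot {N} (suc N) k))
    where
    encode-decodePair : ∀ pj → encode (decodePair pj) ≡ fsuc (uncurry combine pj)
    encode-decodePair (p , fzero)  = refl
    encode-decodePair (p , fsuc j) = refl

  nbhdTree : Vertex → Tr Nbhd
  nbhdTree u = do
    l ← ask (qL u)
    r ← ask (qR u)
    f ← ask (qF u)
    lf ← ask (qL f)
    rf ← ask (qR f)
    h ← ask (qH u)
    leaf (record { left = l ; right = r ; parent = f ; parentLeft = lf ; parentRight = rf ; height = h })

  nbhdTree-depth : ∀ u → DepthLE (nbhdTree u) 6
  nbhdTree-depth u = node≤ λ _ → node≤ λ _ → node≤ λ _ → node≤ λ _ → node≤ λ _ → node≤ λ _ → leaf≤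

  input : (q : MLQuery M) → Tr (MLAns M q)
  input (qS o) = nbhdTree (owner (decode o)) >>= λ v → leaf (encode (succAt (decode o) v))
  input (qP o) = nbhdTree (owner (decode o)) >>= λ v → leaf (encode (predAt (decode o) v))
  input (qW o) = nbhdTree (owner (decode o)) >>= λ v →
    leaf (inject≤ (weightAt (decode o) v) (s≤s (s≤s (ℕₚ.m≤m*n N (suc N)))))

  input-depth : ∀ q → DepthLE (input q) 6
  input-depth (qS o) = DepthLE->>= (nbhdTree-depth _) λ _ → leaf≤
  input-depth (qP o) = DepthLE->>= (nbhdTree-depth _) λ _ → leaf≤
  input-depth (qW o) = DepthLE->>= (nbhdTree-depth _) λ _ → leaf≤

  module Semantics (x : ECQuery n → Vertex) where

    L R F H : Vertex → Vertex
    L = ecL x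
    R = ecR x
    F = ecF x
    H = ecH x

    view : Vertex → Nbhd
    view u = record { left = L u ; right = R u ; parent = F u
                    ; parentLeft = L (F u) ; parentRight = R (F u) ; height = H u }

    succ pred : LineVertex → LineVertex
    succ s = succAt s (view (owner s))
    pred s = predAt s (view (owner s))

    weight : LineVertex → ℕ
    weight s = toℕ (weightAt s (view (owner s)))

    child : Vertex → Vertex
    child u = firstChild u (L u) (R u)

    Dead Adopted Orphan : Vertex → Set
    Dead    u = IsDead u (view u)
    Adopted u = IsAdopted u (view u)
    Orphan  u = IsOrphan u (view u)

    Rung : Vertex → Vertex → Set
    Rung p j = IsRung p j (view p)

    lineOracle : (q : MLQuery M) → MLAns M q
    lineOracle q = eval (input q) x

    lineOracle-succ : ∀ s → lineOracle (qS (encode s)) ≡ encode (succ s)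
    lineOracle-succ s rewrite decode-encode s = refl

    lineOracle-pred : ∀ s → lineOracle (qP (encode s)) ≡ encode (pred s)
    lineOracle-pred s rewrite decode-encode s = refl

    lineOracle-weight : ∀ s → toℕ (lineOracle (qW (encode s))) ≡ weight s
    lineOracle-weight s rewrite decode-encode s = toℕ-inject≤ _ _

    LineSol : LineVertex → Set
    LineSol s =
      pred (succ s) ≢ s
      ⊎ (s ≢ start × weight s ≡ 1)
      ⊎ (0 < weight s × weight (succ s) ≢ weight s + 1)
      ⊎ (1 < weight s × weight s ≢ weight (pred s) + 1)

    mlSol⇒lineSol : ∀ s → MLSol lineOracle (encode s) → LineSol s
    mlSol⇒lineSol start      (inj₁ (_ , inj₁ P0≢0))         = contradiction refl P0≢0
    mlSol⇒lineSol start      (inj₁ (_ , inj₂ (inj₁ ())))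
    mlSol⇒lineSol start      (inj₁ (_ , inj₂ (inj₂ W0≢1)))  = contradiction refl W0≢1
    mlSol⇒lineSol (vertex u) (inj₁ (() , _))
    mlSol⇒lineSol (rung p j) (inj₁ (() , _))
    mlSol⇒lineSol s (inj₂ (inj₁ PS≢s)) = inj₁ λ e → PS≢s (begin
      lineOracle (qP (lineOracle (qS (encode s)))) ≡⟨ cong (lineOracle ∘ qP) (lineOracle-succ s) ⟩
      lineOracle (qP (encode (succ s)))   ≡⟨ lineOracle-pred (succ s) ⟩
      encode (pred (succ s))     ≡⟨ cong encode e ⟩
      encode s                   ∎)
      where open ≡-Reasoning
    mlSol⇒lineSol s (inj₂ (inj₂ (inj₁ (s≢0 , W≡1)))) =
      inj₂ (inj₁ ((λ e → s≢0 (cong encode e)) , trans (sym (lineOracle-weight s)) W≡1))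
    mlSol⇒lineSol s (inj₂ (inj₂ (inj₂ (inj₁ (0<W , bad))))) =
      inj₂ (inj₂ (inj₁ (subst (0 <_) (lineOracle-weight s) 0<W ,
        λ e → bad (trans (lineOracle-weight-succ) (trans e (cong (_+ 1) (sym (lineOracle-weight s))))))))
      where
      lineOracle-weight-succ : toℕ (lineOracle (qW (lineOracle (qS (encode s))))) ≡ weight (succ s)
      lineOracle-weight-succ = trans (cong (toℕ ∘ lineOracle ∘ qW) (lineOracle-succ s)) (lineOracle-weight (succ s))
    mlSol⇒lineSol s (inj₂ (inj₂ (inj₂ (inj₂ (1<W , bad))))) =
      inj₂ (inj₂ (inj₂ (subst (1 <_) (lineOracle-weight s) 1<W ,
        λ e → bad (trans (lineOracle-weight s) (trans e (cong (_+ 1) (sym lineOracle-weight-pred)))))))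
      where
      lineOracle-weight-pred : toℕ (lineOracle (qW (lineOracle (qP (encode s))))) ≡ weight (pred s)
      lineOracle-weight-pred = trans (cong (toℕ ∘ lineOracle ∘ qW) (lineOracle-pred s)) (lineOracle-weight (pred s))

    child-cases : ∀ u → (L u ≢ u × child u ≡ L u) ⊎ (L u ≡ u × child u ≡ R u)
    child-cases u with L u ≟ u
    ... | yes Lu≡u = inj₂ (Lu≡u , refl)
    ... | no  Lu≢u = inj₁ (Lu≢u , refl)

    child-near : ∀ u → ECSol x (child u) → Near x u
    child-near u sol with child-cases u
    ... | inj₁ (_ , c≡L) = near-left x (subst (ECSol x) c≡L sol)
    ... | inj₂ (_ , c≡R) = near-right x (subst (ECSol x) c≡R sol)

    s1-child : ∀ u → F (child u) ≢ u → ECSol x u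
    s1-child u bad with child-cases u
    ... | inj₁ (_ , c≡L) = s1-left x (subst (λ c → F c ≢ u) c≡L bad)
    ... | inj₂ (_ , c≡R) = s1-right x (subst (λ c → F c ≢ u) c≡R bad)

    child≡self : ∀ u → child u ≡ u → L u ≡ u × R u ≡ u
    child≡self u c≡u with child-cases u
    ... | inj₁ (Lu≢u , c≡L) = contradiction (trans (sym c≡L) c≡u) Lu≢u
    ... | inj₂ (Lu≡u , c≡R) = Lu≡u , trans (sym c≡R) c≡u

    dead⇒child≡self : ∀ u → Dead u → child u ≡ u
    dead⇒child≡self u (_ , Lu≡u , Ru≡u) with child-cases u
    ... | inj₁ (Lu≢u , _) = contradiction Lu≡u Lu≢u
    ... | inj₂ (_ , c≡R)  = trans c≡R Ru≡u

    childless-live : ∀ u → ¬ Dead u → child u ≡ u → ECSol x root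
    childless-live u ¬dead c≡u with child≡self u c≡u | u ≟ root
    ... | Lu≡u , _    | yes refl = s2-childless x Lu≡u
    ... | Lu≡u , Ru≡u | no u≢0   = contradiction (u≢0 , Lu≡u , Ru≡u) ¬dead

    adopted-child : ∀ u → child u ≢ u → F (child u) ≡ u → Adopted (child u)
    adopted-child u c≢u Fc≡u =
      subst (λ p → p ≢ child u × firstChild p (L p) (R p) ≡ child u) (sym Fc≡u) (c≢u ∘ sym , refl)

    root-live : ¬ Dead root
    root-live (0≢0 , _) = 0≢0 refl

    weight-live : ∀ u → ¬ Dead u → weight (vertex u) ≡ suc (suc (toℕ (H u)))
    weight-live u ¬dead with isDead? u (view u)
    ... | yes dead = contradiction dead ¬dead
    ... | no  _    = refl

    positive-weight⇒live : ∀ u → 0 < weight (vertex u) → ¬ Dead u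
    positive-weight⇒live u 0<W dead with isDead? u (view u)
    ... | yes _     = ℕₚ.n≮0 0<W
    ... | no  ¬dead = ¬dead dead

    weight≢1 : ∀ s → s ≢ start → weight s ≢ 1
    weight≢1 start      s≢0 = contradiction refl s≢0
    weight≢1 (vertex u) _ with isDead? u (view u)
    ... | yes _ = λ ()
    ... | no  _ = λ ()
    weight≢1 (rung p j) _ with isRung? p j (view p)
    ... | yes _ = λ ()
    ... | no  _ = λ ()

    data PredView (u : Vertex) : LineVertex → Set where
      ofRoot    : u ≡ root → PredView u start
      ofAdopted : u ≢ root → Adopted u → PredView u (vertex (F u))
      ofDead    : ¬ Adopted u → Dead u → PredView u (vertex u)
      ofOrphan  : Orphan u → PredView u (ladder u (H u))

    predView : ∀ u → PredView u (pred (vertex u))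
    predView u with u ≟ root | isAdopted? u (view u) | isDead? u (view u)
    ... | yes u≡0 | _          | _         = ofRoot u≡0
    ... | no  u≢0 | yes adopted | _        = ofAdopted u≢0 adopted
    ... | no  u≢0 | no ¬adopted | yes dead  = ofDead ¬adopted dead
    ... | no  u≢0 | no ¬adopted | no ¬dead = ofOrphan (u≢0 , ¬dead , ¬adopted)

    orphan-pred : ∀ u → Orphan u → pred (vertex u) ≡ ladder u (H u)
    orphan-pred u (u≢0 , ¬dead , ¬adopted) = go (predView u)
      where
      go : ∀ {s} → PredView u s → s ≡ ladder u (H u)
      go (ofRoot u≡0)          = contradiction u≡0 u≢0
      go (ofAdopted _ adopted) = contradiction adopted ¬adopted
      go (ofDead _ dead)       = contradiction dead ¬dead
      go (ofOrphan _)          = refl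

    rung-invalid : ∀ p j → ¬ Rung p j → succ (rung p j) ≡ rung p j × pred (rung p j) ≡ rung p j
    rung-invalid p j ¬r with isRung? p j (view p)
    ... | yes r = contradiction r ¬r
    ... | no  _ = refl , refl

    rung-weight : ∀ {p j} → Rung p j → weight (rung p j) ≡ suc (suc (toℕ j))
    rung-weight {p} {j} r with isRung? p j (view p)
    ... | yes _ = refl
    ... | no ¬r = contradiction r ¬r

    rung-pred : ∀ {p j} → Rung p j → pred (rung p j) ≡ ladder p j
    rung-pred {p} {j} r with isRung? p j (view p)
    ... | yes _ = refl
    ... | no ¬r = contradiction r ¬r

    positive-weight⇒rung : ∀ p j → 0 < weight (rung p j) → Rung p j
    positive-weight⇒rung p j 0<W with isRung? p j (view p)
    ... | yes r = r
    ... | no  _ = contradiction 0<W ℕₚ.n≮0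

    data RungSucc (p j : Vertex) : LineVertex → Set where
      toTop  : suc (toℕ j) ≡ toℕ (H p) → RungSucc p j (vertex p)
      toNext : suc (toℕ j) ≢ toℕ (H p) → RungSucc p j (rung p (inc j))

    rungSucc : ∀ {p j} → Rung p j → RungSucc p j (succ (rung p j))
    rungSucc {p} {j} r with isRung? p j (view p)
    ... | no ¬r = contradiction r ¬r
    ... | yes _ = branch (suc (toℕ j) ℕ.≟ toℕ (H p))
      where
      branch : (d : Dec (suc (toℕ j) ≡ toℕ (H p))) →
               RungSucc p j (if does d then vertex p else rung p (inc j))
      branch (yes top) = toTop top
      branch (no ¬top) = toNext ¬top

    next-rung : ∀ {p j} → Rung p j → suc (toℕ j) ≢ toℕ (H p) →
                Rung p (inc j) × toℕ (inc j) ≡ suc (toℕ j)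
    next-rung {p} {j} (orphan , j<h) ¬top =
      (orphan , subst (_< toℕ (H p)) (sym inc-j≡) (ℕₚ.≤∧≢⇒< j<h ¬top)) , inc-j≡
      where
      inc-j≡ : toℕ (inc j) ≡ suc (toℕ j)
      inc-j≡ = toℕ-inc j (ℕₚ.≤-trans j<h (ℕₚ.≤-pred (toℕ<n (H p))))

    ladder-weight : ∀ {p} k → Orphan p → toℕ k ≤ toℕ (H p) → weight (ladder p k) ≡ suc (toℕ k)
    ladder-weight fzero    _      _   = refl
    ladder-weight {p} (fsuc k) orphan k<h =
      trans (rung-weight (orphan , subst (_< toℕ (H p)) (sym (toℕ-inject₁ k)) k<h))
            (cong (suc ∘ suc) (toℕ-inject₁ k))

    ladder-below : ∀ {p j} k → toℕ k ≡ suc (toℕ j) → ladder p k ≡ rung p j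
    ladder-below {p} (fsuc k) k≡1+j =
      cong (rung p) (toℕ-injective (trans (toℕ-inject₁ k) (ℕₚ.suc-injective k≡1+j)))


    rung-pred∘succ : ∀ p j → pred (succ (rung p j)) ≡ rung p j
    rung-pred∘succ p j = go (isRung? p j (view p))
      where
      go : Dec (Rung p j) → pred (succ (rung p j)) ≡ rung p j
      go (no ¬r) with rung-invalid p j ¬r
      ... | S≡ , P≡ = trans (cong pred S≡) P≡
      go (yes r) = from-succ (rungSucc r)
        where
        from-succ : ∀ {s} → RungSucc p j s → pred s ≡ rung p j
        from-succ (toTop top)   = trans (orphan-pred p (proj₁ r)) (ladder-below (H p) (sym top))
        from-succ (toNext ¬top) with next-rung r ¬top
        ... | r′ , inc-j≡ = trans (rung-pred r′) (ladder-below (inc j) inc-j≡)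

    rung-weight-succ : ∀ {p j} → Rung p j → weight (succ (rung p j)) ≡ weight (rung p j) + 1
    rung-weight-succ {p} {j} r@((_ , ¬dead , _) , _) = go (rungSucc r)
      where
      open ≡-Reasoning
      one-above : suc (suc (suc (toℕ j))) ≡ weight (rung p j) + 1
      one-above = trans (ℕₚ.+-comm 1 (suc (suc (toℕ j)))) (cong (_+ 1) (sym (rung-weight r)))

      go : ∀ {s} → RungSucc p j s → weight s ≡ weight (rung p j) + 1
      go (toTop top) = begin
        weight (vertex p)           ≡⟨ weight-live p ¬dead ⟩
        suc (suc (toℕ (H p)))       ≡⟨ cong (suc ∘ suc) top ⟨
        suc (suc (suc (toℕ j)))     ≡⟨ one-above ⟩
        weight (rung p j) + 1       ∎
      go (toNext ¬top) with next-rung r ¬top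
      ... | r′ , inc-j≡ = begin
        weight (rung p (inc j))     ≡⟨ rung-weight r′ ⟩
        suc (suc (toℕ (inc j)))     ≡⟨ cong (suc ∘ suc) inc-j≡ ⟩
        suc (suc (suc (toℕ j)))     ≡⟨ one-above ⟩
        weight (rung p j) + 1       ∎

    rung-weight-pred : ∀ {p j} → Rung p j → weight (rung p j) ≡ weight (pred (rung p j)) + 1
    rung-weight-pred {p} {j} r@(orphan , j<h) = begin
      weight (rung p j)             ≡⟨ rung-weight r ⟩
      suc (suc (toℕ j))             ≡⟨ ℕₚ.+-comm 1 (suc (toℕ j)) ⟩
      suc (toℕ j) + 1               ≡⟨ cong (_+ 1) (ladder-weight j orphan (ℕₚ.<⇒≤ j<h)) ⟨
      weight (ladder p j) + 1       ≡⟨ cong (λ s → weight s + 1) (rung-pred r) ⟨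
      weight (pred (rung p j)) + 1  ∎
      where open ≡-Reasoning

    dead-loop : ∀ u → Dead u → ∀ {s} → PredView u s → s ≢ vertex u → ECSol x u
    dead-loop u (u≢0 , _) (ofRoot u≡0) _ = contradiction u≡0 u≢0
    dead-loop u (_ , Lu≡u , _) (ofAdopted _ (Fu≢u , _)) _ =
      s1-left x λ FLu≡u → Fu≢u (trans (cong F (sym Lu≡u)) FLu≡u)
    dead-loop u _ (ofDead _ _) s≢u = contradiction refl s≢u
    dead-loop u dead (ofOrphan (_ , ¬dead , _)) _ = contradiction dead ¬dead

    adopted-loop : ∀ u → child u ≢ u → F (child u) ≡ u →
                   ∀ {s} → PredView (child u) s → s ≢ vertex u → Near x u
    adopted-loop u c≢u Fc≡u (ofRoot c≡0) _ =
      near-root x (s2-parented x c≡0 Fc≡u c≢u)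
    adopted-loop u c≢u Fc≡u (ofAdopted _ _) s≢u = contradiction (cong vertex Fc≡u) s≢u
    adopted-loop u c≢u Fc≡u (ofDead ¬adopted _) _ = contradiction (adopted-child u c≢u Fc≡u) ¬adopted
    adopted-loop u c≢u Fc≡u (ofOrphan (_ , _ , ¬adopted)) _ = contradiction (adopted-child u c≢u Fc≡u) ¬adopted

    vertex-pred∘succ : ∀ u → pred (succ (vertex u)) ≢ vertex u → Near x u
    vertex-pred∘succ u loop with isDead? u (view u)
    ... | yes dead = near-self x (dead-loop u dead (predView u)
                       (subst (λ c → pred (vertex c) ≢ vertex u) (dead⇒child≡self u dead) loop))
    ... | no ¬dead with F (child u) ≟ u
    ...   | no Fc≢u = near-self x (s1-child u Fc≢u)
    ...   | yes Fc≡u with child u ≟ u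
    ...     | yes c≡u = near-root x (childless-live u ¬dead c≡u)
    ...     | no  c≢u = adopted-loop u c≢u Fc≡u (predView (child u)) loop

    weight-step : ∀ u c → weight (vertex c) ≢ suc (suc (toℕ (H u))) + 1 →
                  L c ≡ c ⊎ toℕ (H c) ≢ toℕ (H u) + 1
    weight-step u c bad with isDead? c (view c)
    ... | yes (_ , Lc≡c , _) = inj₁ Lc≡c
    ... | no  _              = inj₂ λ e → bad (cong (suc ∘ suc) e)

    vertex-weight-succ : ∀ u → ¬ Dead u →
                         weight (vertex (child u)) ≢ suc (suc (toℕ (H u))) + 1 → Near x u
    vertex-weight-succ u ¬dead bad with F (child u) ≟ u
    ... | no Fc≢u = near-self x (s1-child u Fc≢u)
    ... | yes Fc≡u with child u ≟ u
    ...   | yes c≡u = near-root x (childless-live u ¬dead c≡u)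
    ...   | no  c≢u with child u ≟ root
    ...     | yes c≡0 = near-root x (s2-parented x c≡0 Fc≡u c≢u)
    ...     | no  c≢0 = child-near u (child-sol x Fc≡u c≢u c≢0 (weight-step u (child u) bad))

    vertex-weight-pred : ∀ u → ¬ Dead u → ∀ {s} → PredView u s →
                         suc (suc (toℕ (H u))) ≢ weight s + 1 → Near x u
    vertex-weight-pred u _ (ofRoot refl) bad = near-root x (s4-root x λ H0≡0 → bad (cong (suc ∘ suc) H0≡0))
    vertex-weight-pred u _ (ofAdopted u≢0 (Fu≢u , cFu≡u)) bad =
      near-self x (s4 x u≢0 (Fu≢u ∘ sym) λ e →
        bad (trans (cong (suc ∘ suc) e) (cong (_+ 1) (sym (weight-live (F u) ¬deadF)))))
      where
      ¬deadF : ¬ Dead (F u)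
      ¬deadF dead = Fu≢u (trans (sym (dead⇒child≡self (F u) dead)) cFu≡u)
    vertex-weight-pred u ¬dead (ofDead _ dead) _ = contradiction dead ¬dead
    vertex-weight-pred u _ (ofOrphan orphan) bad = contradiction (sym (trans
      (cong (_+ 1) (ladder-weight (H u) orphan ℕₚ.≤-refl)) (ℕₚ.+-comm (suc (toℕ (H u))) 1))) bad

    lineSol⇒near : ∀ s → LineSol s → Near x (owner s)
    lineSol⇒near start (inj₁ loop) = contradiction refl loop
    lineSol⇒near start (inj₂ (inj₁ (s≢0 , _))) = contradiction refl s≢0
    lineSol⇒near start (inj₂ (inj₂ (inj₁ (_ , bad)))) =
      near-root x (s4-root x λ H0≡0 → bad (trans (weight-live root root-live) (cong (suc ∘ suc) H0≡0)))
    lineSol⇒near start (inj₂ (inj₂ (inj₂ (1<1 , _)))) = contradiction 1<1 (ℕₚ.<-irrefl refl)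
    lineSol⇒near (vertex u) (inj₁ loop) = vertex-pred∘succ u loop
    lineSol⇒near (vertex u) (inj₂ (inj₁ (s≢0 , W≡1))) = contradiction W≡1 (weight≢1 (vertex u) s≢0)
    lineSol⇒near (vertex u) (inj₂ (inj₂ (inj₁ (0<W , bad)))) =
      vertex-weight-succ u ¬dead (subst (λ w → weight (vertex (child u)) ≢ w + 1) (weight-live u ¬dead) bad)
      where
      ¬dead : ¬ Dead u
      ¬dead = positive-weight⇒live u 0<W
    lineSol⇒near (vertex u) (inj₂ (inj₂ (inj₂ (1<W , bad)))) =
      vertex-weight-pred u ¬dead (predView u)
        (subst (λ w → w ≢ weight (pred (vertex u)) + 1) (weight-live u ¬dead) bad)
      where
      ¬dead : ¬ Dead u
      ¬dead = positive-weight⇒live u (ℕₚ.<-trans (s≤s z≤n) 1<W)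
    lineSol⇒near (rung p j) (inj₁ loop) = contradiction (rung-pred∘succ p j) loop
    lineSol⇒near (rung p j) (inj₂ (inj₁ (s≢0 , W≡1))) = contradiction W≡1 (weight≢1 (rung p j) s≢0)
    lineSol⇒near (rung p j) (inj₂ (inj₂ (inj₁ (0<W , bad)))) =
      contradiction (rung-weight-succ (positive-weight⇒rung p j 0<W)) bad
    lineSol⇒near (rung p j) (inj₂ (inj₂ (inj₂ (1<W , bad)))) =
      contradiction (rung-weight-pred (positive-weight⇒rung p j (ℕₚ.<-trans (s≤s z≤n) 1<W))) bad

    correct : ∀ o → MLSol lineOracle o → ECSol x (eval (searchNear (owner (decode o))) x)
    correct o sol = searchNear-correct x (owner (decode o))
      (lineSol⇒near (decode o) (mlSol⇒lineSol (decode o)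
        (subst (MLSol lineOracle) (sym (encode-decode o)) sol)))

EmptyChildWHeight≤SinkOfMeteredLine : EmptyChildWHeight ≤dt SinkOfMeteredLine
EmptyChildWHeight≤SinkOfMeteredLine = record
  { size      = ToSinkOfMeteredLine.M
  ; inp       = ToSinkOfMeteredLine.input
  ; out       = λ n o → searchNear (ToSinkOfMeteredLine.owner n (ToSinkOfMeteredLine.decode n o))
  ; correct   = λ n x → ToSinkOfMeteredLine.Semantics.correct n x
  ; depth     = λ _ → 46
  ; inp-depth = λ n q → DepthLE-weaken (ℕₚ.m≤m+n 6 40) (ToSinkOfMeteredLine.input-depth n q)
  ; out-depth = λ n o → searchNear-depth _
  ; polylog   = 50 , 1 , λ n → ≤-linear⇒≤-polylog 48 2 (⌈log₂ (suc n) ⌉) (log-bound n)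
  }
  where
  log-bound : ∀ n → ⌈log₂ (suc (ToSinkOfMeteredLine.M n)) ⌉ + 46 ≤ 48 + 2 * ⌈log₂ (suc n) ⌉
  log-bound n = ℕₚ.≤-trans (ℕₚ.+-monoˡ-≤ 46 (⌈log₂[1+m*[1+m]]⌉≤ (suc n)))
                           (ℕₚ.≤-reflexive (rearrange ⌈log₂ (suc n) ⌉))
    where
    rearrange : ∀ l → suc l + suc l + 46 ≡ 48 + 2 * l
    rearrange = solve-∀

lemma5p4 : InPLSdt EmptyChildWHeight × InSOPLdt EmptyChildWHeight
lemma5p4 = EmptyChildWHeight≤SinkOfDAG , EmptyChildWHeight≤SinkOfMeteredLine
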